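{- For $x\le y$ and $x'\le y'$ in $\overline{[n]}$, let $$H'((x,y)\otimes(x',y'))=\begin{cases}\chi(x\ge x')+\chi(y\ge y')-\chi(y\ge y'>x\ge x')&\text{if }\overline{y'}\ne x,\\ \chi(x>x')+\chi(y>y')-\chi(y>y'>x>x')&\text{if }\overline{y'}=x.\end{cases}$$ Then $0\le H'((x,y)\otimes(x',y'))\le2$; moreover $H'((x,y)\otimes(x',y'))=2$ if and only if $x\ge y'$; $H'((x,y)\otimes(x',y'))=0$ if and only if either ($x<x'$ and $y<y'$), or $\overline y\ge x=\overline{y'}=x'$, or $\overline y=x=\overline{y'}<x'$; and in all other cases $H'((x,y)\otimes(x',y'))=1$.
   Context: $\overline{[n]}=\{1,\dots,n,\overline n,\dots,\overline1\}$ with total order $1<\dots<n<\overline n<\overline{n-1}<\dots<\overline1$ and $\overline{\overline k}=k$. $\chi(P)=1$ if $P$ holds and $0$ otherwise. -}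

module Defs where

open import Data.Nat using (ℕ; _*_)
import Data.Nat as ℕ
import Data.Nat.Properties as ℕP
open import Data.Fin using (Fin; toℕ; opposite)
import Data.Fin.Properties as FinP
open import Data.Integer using (ℤ; _+_; _-_; +_)
open import Data.Product using (_×_)
open import Relation.Binary.PropositionalEquality using (_≡_)
open import Relation.Nullary using (Dec; yes; no; ¬_; does)
open import Data.Bool using (if_then_else_)
open import Relation.Nullary.Decidable using (_×-dec_)

-- The ordered alphabet [n]‾ = {1,…,n, n‾,…,1‾} with 1<…<n<n‾<…<1‾,
-- encoded by its position in this total order: position p ∈ {0,…,2n-1}.
-- Position p < n is the unbarred letter p+1; position p ≥ n is the barred
-- letter (2n-p)‾.  The order on [n]‾ is the order of positions.
record Barred (n : ℕ) : Set where
  constructor ⟨_⟩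
  field pos : Fin (2 * n)
open Barred public

bar : ∀ {n} → Barred n → Barred n
bar ⟨ p ⟩ = ⟨ opposite p ⟩

_≤ᵇ_ : ∀ {n} → Barred n → Barred n → Set
x ≤ᵇ y = toℕ (pos x) ℕ.≤ toℕ (pos y)

_<ᵇ_ : ∀ {n} → Barred n → Barred n → Set
x <ᵇ y = toℕ (pos x) ℕ.< toℕ (pos y)

_≥ᵇ_ : ∀ {n} → Barred n → Barred n → Set
x ≥ᵇ y = y ≤ᵇ x

_>ᵇ_ : ∀ {n} → Barred n → Barred n → Set
x >ᵇ y = y <ᵇ x

≥ᵇ? : ∀ {n} (x y : Barred n) → Dec (x ≥ᵇ y)
≥ᵇ? x y = toℕ (pos y) ℕP.≤? toℕ (pos x)

>ᵇ? : ∀ {n} (x y : Barred n) → Dec (x >ᵇ y)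
>ᵇ? x y = toℕ (pos y) ℕP.<? toℕ (pos x)

χ : ∀ {P : Set} → Dec P → ℤ
χ d = if does d then + 1 else + 0

-- H'((x,y) ⊗ (x',y'))  (defined for all pairs; the statement assumes x ≤ y, x' ≤ y')
H′ : ∀ {n} → Barred n → Barred n → Barred n → Barred n → ℤ
H′ x y x′ y′ with pos (bar y′) FinP.≟ pos x
... | no _  = (χ (≥ᵇ? x x′) + χ (≥ᵇ? y y′))
              - χ (≥ᵇ? y y′ ×-dec >ᵇ? y′ x ×-dec ≥ᵇ? x x′)
... | yes _ = (χ (>ᵇ? x x′) + χ (>ᵇ? y y′))
              - χ (>ᵇ? y y′ ×-dec >ᵇ? y′ x ×-dec >ᵇ? x x′)

{-# OPTIONS --safe #-}
module Submission where

-- Write H′ = χ P + χ Q − χ (Q ∧ R ∧ P) with R the relation x < y′.  If x ≥ y′ then,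
-- from x ≤ y and x′ ≤ y′, both P and Q hold and R fails, so H′ = 2 (on the diagonal
-- x = ȳ′ the strict comparisons still hold because x ≠ y′ for parity reasons).
-- Otherwise R holds and H′ = χ (P ∨ Q) ∈ {0, 1}, which vanishes iff x, y lie below
-- x′, y′ (strictly off the diagonal, weakly on it); through the bar involution this
-- is exactly the stated zero set.

open import Defs
open import Data.Nat using (ℕ)
open import Data.Integer using (ℤ; +_; _≤_)
open import Data.Product using (_×_)
open import Data.Sum using (_⊎_)
open import Function.Bundles using (_⇔_)
open import Relation.Binary.PropositionalEquality using (_≡_; _≢_)

import Data.Nat as ℕ
import Data.Nat.Properties as ℕP
open import Data.Nat.Properties using (≤∧≢⇒<; m≤n⇒m<n∨m≡n)
open import Data.Fin using (toℕ; opposite)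
import Data.Fin.Properties as FinP
open import Data.Integer using (+≤+; _-_; _+_)
open import Data.Product using (_,_; proj₁; proj₂)
open import Data.Product.Function.NonDependent.Propositional using (_×-⇔_)
open import Data.Sum using (inj₁; inj₂)
open import Data.Empty using (⊥-elim)
open import Function.Bundles using (mk⇔; Equivalence)
import Function.Properties.Equivalence as ⇔
open import Relation.Nullary using (¬_; Dec; yes; no)
open import Relation.Nullary.Decidable using (_×-dec_)
open import Relation.Binary.PropositionalEquality
  using (refl; sym; cong; subst₂; module ≡-Reasoning)
open import Function using (_∘_)

pos-injective : ∀ {n} {x y : Barred n} → pos x ≡ pos y → x ≡ y
pos-injective = cong ⟨_⟩

toℕ-pos-injective : ∀ {n} {x y : Barred n} → toℕ (pos x) ≡ toℕ (pos y) → x ≡ y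
toℕ-pos-injective = pos-injective ∘ FinP.toℕ-injective

<ᵇ⇔≱ᵇ : ∀ {n} {x y : Barred n} → (x <ᵇ y) ⇔ (¬ x ≥ᵇ y)
<ᵇ⇔≱ᵇ = mk⇔ ℕP.<⇒≱ ℕP.≰⇒>

≤ᵇ⇔≯ᵇ : ∀ {n} {x y : Barred n} → (x ≤ᵇ y) ⇔ (¬ x >ᵇ y)
≤ᵇ⇔≯ᵇ = mk⇔ ℕP.≤⇒≯ ℕP.≮⇒≥

bar-involutive : ∀ {n} {x : Barred n} → bar (bar x) ≡ x
bar-involutive {x = ⟨ p ⟩} = cong ⟨_⟩ (FinP.opposite-involutive p)

bar-injective : ∀ {n} {x y : Barred n} → bar x ≡ bar y → x ≡ y
bar-injective {x = x} {y = y} e = begin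
  x             ≡⟨ sym bar-involutive ⟩
  bar (bar x)   ≡⟨ cong bar e ⟩
  bar (bar y)   ≡⟨ bar-involutive ⟩
  y             ∎
  where open ≡-Reasoning

bar-antitone : ∀ {n} {x y : Barred n} → x ≤ᵇ y → bar y ≤ᵇ bar x
bar-antitone {n} {⟨ p ⟩} {⟨ q ⟩} p≤q
  rewrite FinP.opposite-prop p | FinP.opposite-prop q = ℕP.∸-monoʳ-≤ (2 ℕ.* n) (ℕ.s≤s p≤q)

bar-reflects-≤ᵇ : ∀ {n} {x y : Barred n} → bar x ≤ᵇ bar y → y ≤ᵇ x
bar-reflects-≤ᵇ {n} {x} {y} le =
  subst₂ (_≤ᵇ_ {n}) (bar-involutive {x = y}) (bar-involutive {x = x}) (bar-antitone {n} le)

-- Positions p and 2n-1-p have different parities.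
bar-fixed-point-free : ∀ {n} {x : Barred n} → bar x ≢ x
bar-fixed-point-free {n} {⟨ p ⟩} e = ℕP.even≢odd n (toℕ p) (begin
  2 ℕ.* n                           ≡⟨ ℕP.m∸n+n≡m (FinP.toℕ<n p) ⟨
  (2 ℕ.* n ℕ.∸ ℕ.suc i) ℕ.+ ℕ.suc i ≡⟨ cong (ℕ._+ ℕ.suc i) (FinP.opposite-prop p) ⟨
  toℕ (opposite p) ℕ.+ ℕ.suc i      ≡⟨ cong (λ k → toℕ (pos k) ℕ.+ ℕ.suc i) e ⟩
  i ℕ.+ ℕ.suc i                     ≡⟨ ℕP.+-suc i i ⟩
  ℕ.suc (i ℕ.+ i)                   ≡⟨ cong (λ k → ℕ.suc (i ℕ.+ k)) (ℕP.+-identityʳ i) ⟨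
  ℕ.suc (2 ℕ.* i)                   ∎)
  where
  open ≡-Reasoning
  i : ℕ
  i = toℕ p

data ValueIn012 (h : ℤ) (Two Zero : Set) : Set where
  two  : Two → ¬ Zero → h ≡ + 2 → ValueIn012 h Two Zero
  one  : ¬ Two → ¬ Zero → h ≡ + 1 → ValueIn012 h Two Zero
  zero : ¬ Two → Zero → h ≡ + 0 → ValueIn012 h Two Zero

valueIn012-spec : ∀ {h Two Zero} → ValueIn012 h Two Zero →
  ((+ 0 ≤ h) × (h ≤ + 2)) × ((h ≡ + 2) ⇔ Two) × ((h ≡ + 0) ⇔ Zero)
  × (h ≢ + 2 → h ≢ + 0 → h ≡ + 1)
valueIn012-spec (two t ¬z refl) =
  (+≤+ ℕ.z≤n , +≤+ ℕP.≤-refl) , mk⇔ (λ _ → t) (λ _ → refl) ,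
  mk⇔ (λ ()) (⊥-elim ∘ ¬z) , λ h≢2 _ → ⊥-elim (h≢2 refl)
valueIn012-spec (one ¬t ¬z refl) =
  (+≤+ ℕ.z≤n , +≤+ (ℕ.s≤s ℕ.z≤n)) , mk⇔ (λ ()) (⊥-elim ∘ ¬t) ,
  mk⇔ (λ ()) (⊥-elim ∘ ¬z) , λ _ _ → refl
valueIn012-spec (zero ¬t z refl) =
  (+≤+ ℕ.z≤n , +≤+ ℕ.z≤n) , mk⇔ (λ ()) (⊥-elim ∘ ¬t) ,
  mk⇔ (λ _ → z) (λ _ → refl) , λ _ h≢0 → ⊥-elim (h≢0 refl)

χ-correctedSum : ∀ {P Q R : Set} → Dec P → Dec Q → Dec R → ℤ
χ-correctedSum p q r = (χ p + χ q) - χ (q ×-dec r ×-dec p)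

-- Once R holds the correction is χ(P ∧ Q), so the sum is χ(P ∨ Q).
χ-correctedSum-valueIn012 : ∀ {P Q R Two Zero : Set} (p : Dec P) (q : Dec Q) (r : Dec R) →
  (¬ R → P × Q) → (Two ⇔ (¬ R)) → (Zero ⇔ (¬ P × ¬ Q)) →
  ValueIn012 (χ-correctedSum p q r) Two Zero
χ-correctedSum-valueIn012 (yes p) (yes q) (no ¬r) _ two⇔ zero⇔ =
  two (Equivalence.from two⇔ ¬r) (λ z → proj₁ (Equivalence.to zero⇔ z) p) refl
χ-correctedSum-valueIn012 (no ¬p) _ (no ¬r) both _ _ = ⊥-elim (¬p (proj₁ (both ¬r)))
χ-correctedSum-valueIn012 (yes _) (no ¬q) (no ¬r) both _ _ = ⊥-elim (¬q (proj₂ (both ¬r)))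
χ-correctedSum-valueIn012 (yes p) (yes _) (yes r) _ two⇔ zero⇔ =
  one (λ t → Equivalence.to two⇔ t r) (λ z → proj₁ (Equivalence.to zero⇔ z) p) refl
χ-correctedSum-valueIn012 (yes p) (no _) (yes r) _ two⇔ zero⇔ =
  one (λ t → Equivalence.to two⇔ t r) (λ z → proj₁ (Equivalence.to zero⇔ z) p) refl
χ-correctedSum-valueIn012 (no _) (yes q) (yes r) _ two⇔ zero⇔ =
  one (λ t → Equivalence.to two⇔ t r) (λ z → proj₂ (Equivalence.to zero⇔ z) q) refl
χ-correctedSum-valueIn012 (no ¬p) (no ¬q) (yes r) _ two⇔ zero⇔ =
  zero (λ t → Equivalence.to two⇔ t r) (Equivalence.from zero⇔ (¬p , ¬q)) refl

ZeroSet : ∀ {n} → Barred n → Barred n → Barred n → Barred n → Set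
ZeroSet x y x′ y′ =
  ((x <ᵇ x′) × (y <ᵇ y′))
  ⊎ ((bar y ≥ᵇ x) × (x ≡ bar y′) × (bar y′ ≡ x′))
  ⊎ ((bar y ≡ x) × (x ≡ bar y′) × (bar y′ <ᵇ x′))

zeroSet-off-diagonal : ∀ {n} {x y x′ y′ : Barred n} → x ≢ bar y′ →
  ZeroSet x y x′ y′ ⇔ ((x <ᵇ x′) × (y <ᵇ y′))
zeroSet-off-diagonal {n} {x} {y} {x′} {y′} x≢ = mk⇔ from-zeroSet inj₁
  where
  from-zeroSet : ZeroSet x y x′ y′ → (x <ᵇ x′) × (y <ᵇ y′)
  from-zeroSet (inj₁ lt) = lt
  from-zeroSet (inj₂ (inj₁ (_ , x≡ , _))) = ⊥-elim (x≢ x≡)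
  from-zeroSet (inj₂ (inj₂ (_ , x≡ , _))) = ⊥-elim (x≢ x≡)

zeroSet-on-diagonal : ∀ {n} {y x′ y′ : Barred n} →
  ZeroSet (bar y′) y x′ y′ ⇔ ((bar y′ ≤ᵇ x′) × (y ≤ᵇ y′))
zeroSet-on-diagonal {n} {y} {x′} {y′} = mk⇔ from-zeroSet to-zeroSet
  where
  from-zeroSet : ZeroSet (bar y′) y x′ y′ → (bar y′ ≤ᵇ x′) × (y ≤ᵇ y′)
  from-zeroSet (inj₁ (x<x′ , y<y′)) = ℕP.<⇒≤ x<x′ , ℕP.<⇒≤ y<y′
  from-zeroSet (inj₂ (inj₁ (x≤ȳ , _ , refl))) = ℕP.≤-refl , bar-reflects-≤ᵇ {n} x≤ȳ
  from-zeroSet (inj₂ (inj₂ (ȳ≡x , _ , x<x′))) =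
    ℕP.<⇒≤ x<x′ , ℕP.≤-reflexive (cong (toℕ ∘ pos) (bar-injective ȳ≡x))

  to-zeroSet : (bar y′ ≤ᵇ x′) × (y ≤ᵇ y′) → ZeroSet (bar y′) y x′ y′
  to-zeroSet (x≤x′ , y≤y′) with m≤n⇒m<n∨m≡n x≤x′ | m≤n⇒m<n∨m≡n y≤y′
  ... | inj₂ x≡x′ | _         = inj₂ (inj₁ (bar-antitone {n} y≤y′ , refl , toℕ-pos-injective x≡x′))
  ... | inj₁ x<x′ | inj₁ y<y′ = inj₁ (x<x′ , y<y′)
  ... | inj₁ x<x′ | inj₂ y≡y′ = inj₂ (inj₂ (cong bar (toℕ-pos-injective y≡y′) , refl , x<x′))

H′-off-diagonal : ∀ {n} {x y x′ y′ : Barred n} → x ≤ᵇ y → x′ ≤ᵇ y′ → x ≢ bar y′ →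
  ValueIn012 (χ-correctedSum (≥ᵇ? x x′) (≥ᵇ? y y′) (>ᵇ? y′ x)) (x ≥ᵇ y′) (ZeroSet x y x′ y′)
H′-off-diagonal {n} {x} {y} {x′} {y′} x≤y x′≤y′ x≢ =
  χ-correctedSum-valueIn012 (≥ᵇ? x x′) (≥ᵇ? y y′) (>ᵇ? y′ x) dominated (≤ᵇ⇔≯ᵇ {n})
    (⇔.trans (zeroSet-off-diagonal x≢) (<ᵇ⇔≱ᵇ {n} ×-⇔ <ᵇ⇔≱ᵇ {n}))
  where
  dominated : ¬ x <ᵇ y′ → (x ≥ᵇ x′) × (y ≥ᵇ y′)
  dominated ¬x<y′ = ℕP.≤-trans x′≤y′ y′≤x , ℕP.≤-trans y′≤x x≤y
    where
    y′≤x : y′ ≤ᵇ x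
    y′≤x = ℕP.≮⇒≥ ¬x<y′

-- On the diagonal x = ȳ′ we have x ≠ y′, so ¬ x < y′ already gives y′ < x.
H′-on-diagonal : ∀ {n} {x y x′ y′ : Barred n} → x ≤ᵇ y → x′ ≤ᵇ y′ → x ≡ bar y′ →
  ValueIn012 (χ-correctedSum (>ᵇ? x x′) (>ᵇ? y y′) (>ᵇ? y′ x)) (x ≥ᵇ y′) (ZeroSet x y x′ y′)
H′-on-diagonal {n} {y = y} {x′} {y′} x≤y x′≤y′ refl =
  χ-correctedSum-valueIn012 (>ᵇ? (bar y′) x′) (>ᵇ? y y′) (>ᵇ? y′ (bar y′)) dominated (≤ᵇ⇔≯ᵇ {n})
    (⇔.trans zeroSet-on-diagonal (≤ᵇ⇔≯ᵇ {n} ×-⇔ ≤ᵇ⇔≯ᵇ {n}))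
  where
  dominated : ¬ bar y′ <ᵇ y′ → (bar y′ >ᵇ x′) × (y >ᵇ y′)
  dominated ¬x<y′ = ℕP.≤-<-trans x′≤y′ y′<x , ℕP.<-≤-trans y′<x x≤y
    where
    y′<x : y′ <ᵇ bar y′
    y′<x = ≤∧≢⇒< (ℕP.≮⇒≥ ¬x<y′) (λ e → bar-fixed-point-free {n} (sym (toℕ-pos-injective e)))

H′-valueIn012 : ∀ {n} {x y x′ y′ : Barred n} → x ≤ᵇ y → x′ ≤ᵇ y′ →
  ValueIn012 (H′ x y x′ y′) (x ≥ᵇ y′) (ZeroSet x y x′ y′)
H′-valueIn012 {x = x} {y′ = y′} x≤y x′≤y′ with pos (bar y′) FinP.≟ pos x
... | no  ȳ′≢x = H′-off-diagonal x≤y x′≤y′ (λ x≡ȳ′ → ȳ′≢x (cong pos (sym x≡ȳ′)))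
... | yes ȳ′≡x = H′-on-diagonal x≤y x′≤y′ (sym (pos-injective ȳ′≡x))

lemma2p4 : (n : ℕ) (x y x′ y′ : Barred n) → x ≤ᵇ y → x′ ≤ᵇ y′ →
    ((+ 0 ≤ H′ x y x′ y′) × (H′ x y x′ y′ ≤ + 2))
    × ((H′ x y x′ y′ ≡ + 2) ⇔ (x ≥ᵇ y′))
    × ((H′ x y x′ y′ ≡ + 0) ⇔
        (((x <ᵇ x′) × (y <ᵇ y′))
         ⊎ ((bar y ≥ᵇ x) × (x ≡ bar y′) × (bar y′ ≡ x′))
         ⊎ ((bar y ≡ x) × (x ≡ bar y′) × (bar y′ <ᵇ x′))))
    × (H′ x y x′ y′ ≢ + 2 → H′ x y x′ y′ ≢ + 0 → H′ x y x′ y′ ≡ + 1)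
lemma2p4 n x y x′ y′ x≤y x′≤y′ = valueIn012-spec (H′-valueIn012 x≤y x′≤y′)
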